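{- Let $L$ be a principal MS-algebra with smallest dense element $d_L$. The set $A(L)$ of all MS-congruence pairs of $L$ is a sublattice of $\mathrm{Con}(L^{\circ\circ})\times\mathrm{Con}(D(L))$, and the map $\theta\mapsto(\theta_{L^{\circ\circ}},\theta_{D(L)})$ (restrictions of $\theta$ to $L^{\circ\circ}$ and $D(L)$) is an isomorphism from the congruence lattice $\mathrm{Con}(L)$ onto $A(L)$.
   Context: An MS-algebra is an algebra $(L;\vee,\wedge,{}^{\circ},0,1)$ where $(L;\vee,\wedge,0,1)$ is a bounded distributive lattice and ${}^{\circ}$ is a unary operation with $x\le x^{\circ\circ}$, $(x\wedge y)^{\circ}=x^{\circ}\vee y^{\circ}$ and $1^{\circ}=0$. For such $L$, $L^{\circ\circ}=\{x\in L\mid x=x^{\circ\circ}\}$ is a subalgebra which is a de Morgan algebra (an MS-algebra with $x=x^{\circ\circ}$), and $D(L)=\{x\in L\mid x^{\circ}=0\}$ is a filter. $L$ is a principal MS-algebra if there is $d_L\in L$ with $D(L)=[d_L)=\{x\mid x\ge d_L\}$ and $x=x^{\circ\circ}\wedge(x\vee d_L)$ for all $x\in L$. $\mathrm{Con}(L^{\circ\circ})$ denotes the congruence lattice of the de Morgan algebra $L^{\circ\circ}$ and $\mathrm{Con}(D(L))$ the congruence lattice of the lattice $D(L)$. An MS-congruence pair of $L$ is a pair $(\theta_1,\theta_2)\in\mathrm{Con}(L^{\circ\circ})\times\mathrm{Con}(D(L))$ such that $(a,b)\in\theta_1$ implies $(a\vee d_L,b\vee d_L)\in\theta_2$. -}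

module Defs where

open import Level using (0ℓ)
open import Data.Unit using (⊤)
open import Data.Product using (Σ; _×_; _,_)
open import Data.Sum using (_⊎_)
open import Function.Bundles using (_⇔_)
open import Relation.Binary.Core using (Rel)
open import Relation.Binary.PropositionalEquality using (_≡_)
open import Relation.Binary.Construct.Closure.ReflexiveTransitive using (Star)
open import Relation.Unary using (Pred)
open import Algebra.Core using (Op₁; Op₂)
open import Algebra.Lattice.Structures using (IsDistributiveLattice)

record MSAlgebra : Set₁ where
  infixr 7 _∧_
  infixr 6 _∨_
  infix  8 _°
  field
    Carrier  : Set
    _∨_ _∧_  : Op₂ Carrier
    _°       : Op₁ Carrier
    ⊥L ⊤L    : Carrier
    isDistributiveLattice : IsDistributiveLattice _≡_ _∨_ _∧_
    ⊥L-least    : ∀ x → ⊥L ∧ x ≡ ⊥L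
    ⊤L-greatest : ∀ x → x ∧ ⊤L ≡ x

  infix 4 _≤_
  _≤_ : Rel Carrier 0ℓ
  x ≤ y = x ∧ y ≡ x

  field
    x≤x°°   : ∀ x → x ≤ (x °) °
    °-∧     : ∀ x y → (x ∧ y) ° ≡ x ° ∨ y °
    ⊤L°     : ⊤L ° ≡ ⊥L

  L°° : Pred Carrier 0ℓ
  L°° x = x ≡ (x °) °

  D : Pred Carrier 0ℓ
  D x = x ° ≡ ⊥L

  U : Pred Carrier 0ℓ
  U _ = ⊤

record Principal (L : MSAlgebra) : Set where
  open MSAlgebra L
  field
    d       : Carrier
    D-is-↑d   : ∀ x → D x ⇔ (d ≤ x)
    decomp  : ∀ x → x ≡ (x °) ° ∧ (x ∨ d)

-- A congruence of the subalgebra S (closed under the relevant operations)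
-- is represented by a relation θ on the carrier of L of which only the
-- pairs with both components in S are relevant.

module Congruences (L : MSAlgebra) where
  open MSAlgebra L

  record IsLatCongOn (S : Pred Carrier 0ℓ) (θ : Rel Carrier 0ℓ) : Set where
    field
      reflexive  : ∀ {x} → S x → θ x x
      symmetric  : ∀ {x y} → S x → S y → θ x y → θ y x
      transitive : ∀ {x y z} → S x → S y → S z → θ x y → θ y z → θ x z
      ∨-compat   : ∀ {x y u v} → S x → S y → S u → S v →
                   θ x y → θ u v → θ (x ∨ u) (y ∨ v)
      ∧-compat   : ∀ {x y u v} → S x → S y → S u → S v →
                   θ x y → θ u v → θ (x ∧ u) (y ∧ v)

  -- congruence of the subalgebra S w.r.t. _∨_, _∧_ and _°
  -- (constants are automatically respected)
  record IsMSCongOn (S : Pred Carrier 0ℓ) (θ : Rel Carrier 0ℓ) : Set where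
    field
      isLatCong : IsLatCongOn S θ
      °-compat  : ∀ {x y} → S x → S y → θ x y → θ (x °) (y °)

  IsCon : Rel Carrier 0ℓ → Set
  IsCon = IsMSCongOn U

  IsConL°° : Rel Carrier 0ℓ → Set
  IsConL°° = IsMSCongOn L°°

  IsConD : Rel Carrier 0ℓ → Set
  IsConD = IsLatCongOn D

  _∩_ : Rel Carrier 0ℓ → Rel Carrier 0ℓ → Rel Carrier 0ℓ
  (θ ∩ φ) x y = θ x y × φ x y

  join : Pred Carrier 0ℓ → Rel Carrier 0ℓ → Rel Carrier 0ℓ → Rel Carrier 0ℓ
  join S θ φ = Star (λ x y → S x × S y × (θ x y ⊎ φ x y))

  _≐[_]_ : Rel Carrier 0ℓ → Pred Carrier 0ℓ → Rel Carrier 0ℓ → Set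
  θ ≐[ S ] φ = ∀ {x y} → S x → S y → θ x y ⇔ φ x y

  restrict : Rel Carrier 0ℓ → Pred Carrier 0ℓ → Rel Carrier 0ℓ
  restrict θ S x y = S x × S y × θ x y

module MSPairs (L : MSAlgebra) (P : Principal L) where
  open MSAlgebra L
  open Principal P
  open Congruences L

  IsMSPair : Rel Carrier 0ℓ → Rel Carrier 0ℓ → Set
  IsMSPair θ₁ θ₂ =
    IsConL°° θ₁ × IsConD θ₂ ×
    (∀ {a b} → L°° a → L°° b → θ₁ a b → θ₂ (a ∨ d) (b ∨ d))

  Φ₁ Φ₂ : Rel Carrier 0ℓ → Rel Carrier 0ℓ
  Φ₁ θ = restrict θ L°°
  Φ₂ θ = restrict θ D

  AIsSublattice : Set₁
  AIsSublattice = ∀ θ₁ θ₂ φ₁ φ₂ → IsMSPair θ₁ θ₂ → IsMSPair φ₁ φ₂ →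
    IsMSPair (θ₁ ∩ φ₁) (θ₂ ∩ φ₂) ×
    IsMSPair (join L°° θ₁ φ₁) (join D θ₂ φ₂)

  record ΦIsIsomorphism : Set₁ where
    field
      into       : ∀ θ → IsCon θ → IsMSPair (Φ₁ θ) (Φ₂ θ)
      injective  : ∀ θ φ → IsCon θ → IsCon φ →
                   Φ₁ θ ≐[ L°° ] Φ₁ φ → Φ₂ θ ≐[ D ] Φ₂ φ → θ ≐[ U ] φ
      surjective : ∀ θ₁ θ₂ → IsMSPair θ₁ θ₂ →
                   Σ (Rel Carrier 0ℓ) λ θ → IsCon θ ×
                     Φ₁ θ ≐[ L°° ] θ₁ × Φ₂ θ ≐[ D ] θ₂
      pres-meet  : ∀ θ φ → IsCon θ → IsCon φ →
                   Φ₁ (θ ∩ φ) ≐[ L°° ] (Φ₁ θ ∩ Φ₁ φ) ×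
                   Φ₂ (θ ∩ φ) ≐[ D ] (Φ₂ θ ∩ Φ₂ φ)
      pres-join  : ∀ θ φ → IsCon θ → IsCon φ →
                   Φ₁ (join U θ φ) ≐[ L°° ] join L°° (Φ₁ θ) (Φ₁ φ) ×
                   Φ₂ (join U θ φ) ≐[ D ] join D (Φ₂ θ) (Φ₂ φ)

-- Everything rests on two retractions of a principal MS-algebra L: the
-- lattice endomorphism x ↦ x°° onto the de Morgan subalgebra L°°, and
-- x ↦ x ∨ d onto the filter D(L) = [d).  Both fix their image pointwise and
-- preserve ∨ and ∧.  For an arbitrary subset S admitting such a retraction r
-- we show: meets and joins (transitive closures of unions) of lattice
-- congruences of S are congruences of S; the pullback of a congruence of S
-- along r is a congruence of L; restricting a congruence of L to S gives a
-- congruence of S, and restriction commutes with meets and, for congruences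
-- compatible with r, with joins.
-- The decomposition x = x°° ∧ (x ∨ d) shows that a congruence of L is
-- determined by what it does on the elements x°° and x ∨ d; this gives
-- injectivity of θ ↦ (θ|L°°, θ|D(L)).  Conversely an MS-congruence pair
-- (θ₁ , θ₂) is the image of the intersection of the pullbacks of θ₁ and θ₂,
-- the pair condition providing compatibility with °.  That A(L) is closed
-- under meets and joins follows from the general facts about congruences.

module Submission where

open import Defs
open import Level using (0ℓ)
open import Data.Product using (_×_; _,_; proj₂)
open import Data.Sum using (_⊎_; inj₁; inj₂)
open import Data.Unit using (tt)
open import Function using (id)
open import Function.Bundles using (_⇔_; mk⇔; Equivalence)
open import Function.Properties.Equivalence using () renaming (sym to ⇔-sym)
open import Relation.Binary.Core using (Rel)
open import Relation.Binary.PropositionalEquality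
  using (_≡_; sym; trans; cong; cong₂; subst; subst₂; module ≡-Reasoning)
open import Relation.Binary.Construct.Closure.ReflexiveTransitive
  using (ε; _◅◅_; gmap; reverse)
open import Relation.Unary using (Pred)
open import Algebra.Bundles using (CommutativeSemigroup)
open import Algebra.Lattice.Bundles using (DistributiveLattice)
open import Algebra.Lattice.Structures using (IsDistributiveLattice)
import Algebra.Lattice.Properties.Lattice as LatticeProperties
import Algebra.Properties.CommutativeSemigroup as CommutativeSemigroupProperties
import Relation.Binary.Lattice as OrderTheoretic

module _ (L : MSAlgebra) where
  open MSAlgebra L
  open Congruences L
  open IsDistributiveLattice isDistributiveLattice
    using (∨-comm; ∧-comm; ∨-absorbs-∧; ∨-distribʳ-∧)
  open IsLatCongOn
  open IsMSCongOn
  open ≡-Reasoning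

  private
    distributiveLattice : DistributiveLattice 0ℓ 0ℓ
    distributiveLattice = record { isDistributiveLattice = isDistributiveLattice }

  open LatticeProperties (DistributiveLattice.lattice distributiveLattice)
    using (∨-idem; ∨-isSemigroup; ∨-∧-orderTheoreticLattice)

  open OrderTheoretic.Lattice ∨-∧-orderTheoreticLattice
    using (x≤x∨y; y≤x∨y; ∨-least; ∧-greatest; antisym)
    renaming (_≤_ to _⊑_; trans to ⊑-trans)

  private
    ∨-commutativeSemigroup : CommutativeSemigroup 0ℓ 0ℓ
    ∨-commutativeSemigroup = record
      { isCommutativeSemigroup = record { isSemigroup = ∨-isSemigroup ; comm = ∨-comm } }

  open CommutativeSemigroupProperties ∨-commutativeSemigroup using (interchange)

  x⊑x°° : ∀ x → x ⊑ x ° °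
  x⊑x°° x = sym (x≤x°° x)

  -- ° is antitone: x = x ∧ y gives x° = x° ∨ y°, which lies above y°.
  °-antitone : ∀ {x y} → x ⊑ y → y ° ⊑ x °
  °-antitone {x} {y} x⊑y = subst (y ° ⊑_) x°∨y°≡x° (y≤x∨y (x °) (y °))
    where
    x°∨y°≡x° : x ° ∨ y ° ≡ x °
    x°∨y°≡x° = trans (sym (°-∧ x y)) (cong _° (sym x⊑y))

  °°° : ∀ x → x ° ° ° ≡ x °
  °°° x = antisym (°-antitone (x⊑x°° x)) (x⊑x°° (x °))

  L°°-° : ∀ x → L°° (x °)
  L°°-° x = sym (°°° x)

  °-∨ : ∀ x y → (x ∨ y) ° ≡ x ° ∧ y °
  °-∨ x y = antisym (∧-greatest (°-antitone (x≤x∨y x y)) (°-antitone (y≤x∨y x y)))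
                    (⊑-trans (x⊑x°° (x ° ∧ y °)) (°-antitone x∨y⊑[x°∧y°]°))
    where
    x∨y⊑[x°∧y°]° : x ∨ y ⊑ (x ° ∧ y °) °
    x∨y⊑[x°∧y°]° = subst (x ∨ y ⊑_) (sym (°-∧ (x °) (y °)))
      (∨-least (⊑-trans (x⊑x°° x) (x≤x∨y _ _)) (⊑-trans (x⊑x°° y) (y≤x∨y _ _)))

  °°-∨ : ∀ x y → (x ∨ y) ° ° ≡ x ° ° ∨ y ° °
  °°-∨ x y = trans (cong _° (°-∨ x y)) (°-∧ (x °) (y °))

  °°-∧ : ∀ x y → (x ∧ y) ° ° ≡ x ° ° ∧ y ° °
  °°-∧ x y = trans (cong _° (°-∧ x y)) (°-∨ (x °) (y °))

  record Retraction (S : Pred Carrier 0ℓ) : Set where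
    field
      r     : Carrier → Carrier
      lands : ∀ x → S (r x)
      fixes : ∀ {x} → S x → r x ≡ x
      r-∨   : ∀ x y → r (x ∨ y) ≡ r x ∨ r y
      r-∧   : ∀ x y → r (x ∧ y) ≡ r x ∧ r y

    ∨-closed : ∀ {x y} → S x → S y → S (x ∨ y)
    ∨-closed {x} {y} sx sy =
      subst S (trans (r-∨ x y) (cong₂ _∨_ (fixes sx) (fixes sy))) (lands (x ∨ y))

    ∧-closed : ∀ {x y} → S x → S y → S (x ∧ y)
    ∧-closed {x} {y} sx sy =
      subst S (trans (r-∧ x y) (cong₂ _∧_ (fixes sx) (fixes sy))) (lands (x ∧ y))

  open Retraction

  CompatibleWith : (Carrier → Carrier) → Rel Carrier 0ℓ → Set
  CompatibleWith f θ = ∀ {x y} → θ x y → θ (f x) (f y)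

  module Translations {S : Pred Carrier 0ℓ} {θ : Rel Carrier 0ℓ} (c : IsLatCongOn S θ) where
    ∨-right : ∀ {u} → S u → ∀ {x y} → S x → S y → θ x y → θ (x ∨ u) (y ∨ u)
    ∨-right su sx sy t = ∨-compat c sx sy su su t (reflexive c su)

    ∨-left : ∀ {u} → S u → ∀ {x y} → S x → S y → θ x y → θ (u ∨ x) (u ∨ y)
    ∨-left su sx sy t = ∨-compat c su su sx sy (reflexive c su) t

    ∧-right : ∀ {u} → S u → ∀ {x y} → S x → S y → θ x y → θ (x ∧ u) (y ∧ u)
    ∧-right su sx sy t = ∧-compat c sx sy su su t (reflexive c su)

    ∧-left : ∀ {u} → S u → ∀ {x y} → S x → S y → θ x y → θ (u ∧ x) (u ∧ y)
    ∧-left su sx sy t = ∧-compat c su su sx sy (reflexive c su) t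

  open Translations

  join-map : ∀ {S S' : Pred Carrier 0ℓ} {θ φ θ' φ' : Rel Carrier 0ℓ} (f : Carrier → Carrier) →
             (∀ {x} → S x → S' (f x)) →
             (∀ {x y} → S x → S y → θ x y → θ' (f x) (f y)) →
             (∀ {x y} → S x → S y → φ x y → φ' (f x) (f y)) →
             ∀ {x y} → join S θ φ x y → join S' θ' φ' (f x) (f y)
  join-map {S} {S'} {θ} {φ} {θ'} {φ'} f f-S f-θ f-φ = gmap f step
    where
    step : ∀ {x y} → S x × S y × (θ x y ⊎ φ x y) →
           S' (f x) × S' (f y) × (θ' (f x) (f y) ⊎ φ' (f x) (f y))
    step (sx , sy , inj₁ t) = f-S sx , f-S sy , inj₁ (f-θ sx sy t)
    step (sx , sy , inj₂ t) = f-S sx , f-S sy , inj₂ (f-φ sx sy t)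

  ∩-isLatCong : ∀ {S θ φ} → IsLatCongOn S θ → IsLatCongOn S φ → IsLatCongOn S (θ ∩ φ)
  ∩-isLatCong cθ cφ = record
    { reflexive  = λ sx → reflexive cθ sx , reflexive cφ sx
    ; symmetric  = λ sx sy (t , u) → symmetric cθ sx sy t , symmetric cφ sx sy u
    ; transitive = λ sx sy sz (t , u) (t' , u') →
        transitive cθ sx sy sz t t' , transitive cφ sx sy sz u u'
    ; ∨-compat   = λ sx sy su sv (t , u) (t' , u') →
        ∨-compat cθ sx sy su sv t t' , ∨-compat cφ sx sy su sv u u'
    ; ∧-compat   = λ sx sy su sv (t , u) (t' , u') →
        ∧-compat cθ sx sy su sv t t' , ∧-compat cφ sx sy su sv u u'
    }

  -- Joins in Con(S), for S a sublattice, are transitive closures of unions: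
  -- to pass from x ∨ u to y ∨ v, first move x to y along one chain, then u to v.
  join-isLatCong : ∀ {S θ φ} →
                   (∀ {x y} → S x → S y → S (x ∨ y)) → (∀ {x y} → S x → S y → S (x ∧ y)) →
                   IsLatCongOn S θ → IsLatCongOn S φ → IsLatCongOn S (join S θ φ)
  join-isLatCong {S} {θ} {φ} S-∨ S-∧ cθ cφ = record
    { reflexive  = λ _ → ε
    ; symmetric  = λ _ _ → reverse flip-step
    ; transitive = λ _ _ _ → _◅◅_
    ; ∨-compat   = λ {_} {y} {u} _ sy su _ p q →
        join-map (_∨ u) (λ sz → S-∨ sz su) (∨-right cθ su) (∨-right cφ su) p
        ◅◅ join-map (y ∨_) (S-∨ sy) (∨-left cθ sy) (∨-left cφ sy) q
    ; ∧-compat   = λ {_} {y} {u} _ sy su _ p q →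
        join-map (_∧ u) (λ sz → S-∧ sz su) (∧-right cθ su) (∧-right cφ su) p
        ◅◅ join-map (y ∧_) (S-∧ sy) (∧-left cθ sy) (∧-left cφ sy) q
    }
    where
    flip-step : ∀ {x y} → S x × S y × (θ x y ⊎ φ x y) → S y × S x × (θ y x ⊎ φ y x)
    flip-step (sx , sy , inj₁ t) = sy , sx , inj₁ (symmetric cθ sx sy t)
    flip-step (sx , sy , inj₂ t) = sy , sx , inj₂ (symmetric cφ sx sy t)

  pullback : (Carrier → Carrier) → Rel Carrier 0ℓ → Rel Carrier 0ℓ
  pullback f θ x y = θ (f x) (f y)

  pullback-isLatCong : ∀ {S θ} (R : Retraction S) → IsLatCongOn S θ →
                       IsLatCongOn U (pullback (r R) θ)
  pullback-isLatCong {θ = θ} R c = record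
    { reflexive  = λ {x} _ → reflexive c (lands R x)
    ; symmetric  = λ {x} {y} _ _ → symmetric c (lands R x) (lands R y)
    ; transitive = λ {x} {y} {z} _ _ _ → transitive c (lands R x) (lands R y) (lands R z)
    ; ∨-compat   = λ {x} {y} {u} {v} _ _ _ _ p q →
        subst₂ θ (sym (r-∨ R x u)) (sym (r-∨ R y v))
          (∨-compat c (lands R x) (lands R y) (lands R u) (lands R v) p q)
    ; ∧-compat   = λ {x} {y} {u} {v} _ _ _ _ p q →
        subst₂ θ (sym (r-∧ R x u)) (sym (r-∧ R y v))
          (∧-compat c (lands R x) (lands R y) (lands R u) (lands R v) p q)
    }

  pullback-on-image : ∀ {S} (R : Retraction S) θ → ∀ {x y} → S x → S y →
                      pullback (r R) θ x y ⇔ θ x y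
  pullback-on-image R θ sx sy =
    mk⇔ (subst₂ θ (fixes R sx) (fixes R sy)) (subst₂ θ (sym (fixes R sx)) (sym (fixes R sy)))

  restrict-isLatCong : ∀ {S θ} → Retraction S → IsLatCongOn U θ → IsLatCongOn S (restrict θ S)
  restrict-isLatCong R c = record
    { reflexive  = λ sx → sx , sx , reflexive c tt
    ; symmetric  = λ sx sy (_ , _ , t) → sy , sx , symmetric c tt tt t
    ; transitive = λ sx _ sz (_ , _ , t) (_ , _ , u) → sx , sz , transitive c tt tt tt t u
    ; ∨-compat   = λ sx sy su sv (_ , _ , t) (_ , _ , u) →
        ∨-closed R sx su , ∨-closed R sy sv , ∨-compat c tt tt tt tt t u
    ; ∧-compat   = λ sx sy su sv (_ , _ , t) (_ , _ , u) →
        ∧-closed R sx su , ∧-closed R sy sv , ∧-compat c tt tt tt tt t u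
    }

  restrict-∩ : ∀ S θ φ → restrict (θ ∩ φ) S ≐[ S ] (restrict θ S ∩ restrict φ S)
  restrict-∩ S θ φ sx sy =
    mk⇔ (λ (_ , _ , t , u) → (sx , sy , t) , (sx , sy , u))
        (λ ((_ , _ , t) , (_ , _ , u)) → sx , sy , t , u)

  -- Restriction to a retract preserves joins of relations compatible with the
  -- retraction: r carries a chain in L from x to y to a chain in S from
  -- r x = x to r y = y.
  restrict-join : ∀ {S θ φ} (R : Retraction S) → CompatibleWith (r R) θ → CompatibleWith (r R) φ →
                  restrict (join U θ φ) S ≐[ S ] join S (restrict θ S) (restrict φ S)
  restrict-join {S} {θ} {φ} R θ-r φ-r sx sy = mk⇔
    (λ (_ , _ , chain) → subst₂ (join S (restrict θ S) (restrict φ S)) (fixes R sx) (fixes R sy)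
       (join-map (r R) (λ {z} _ → lands R z)
                 (λ {z} {w} _ _ t → lands R z , lands R w , θ-r t)
                 (λ {z} {w} _ _ t → lands R z , lands R w , φ-r t) chain))
    (λ chain → sx , sy ,
       join-map id (λ _ → tt) (λ _ _ (_ , _ , t) → t) (λ _ _ (_ , _ , t) → t) chain)

  ∨-compatible : ∀ {θ} → IsCon θ → ∀ u → CompatibleWith (_∨ u) θ
  ∨-compatible c u = ∨-right (isLatCong c) tt tt tt

  °°-retraction : Retraction L°°
  °°-retraction = record
    { r = λ x → x ° ° ; lands = λ x → L°°-° (x °) ; fixes = sym ; r-∨ = °°-∨ ; r-∧ = °°-∧ }

  °°-compatible : ∀ {θ} → IsCon θ → CompatibleWith (λ x → x ° °) θ
  °°-compatible c t = °-compat c tt tt (°-compat c tt tt t)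

  ∩-isConL°° : ∀ {θ φ} → IsConL°° θ → IsConL°° φ → IsConL°° (θ ∩ φ)
  ∩-isConL°° cθ cφ = record
    { isLatCong = ∩-isLatCong (isLatCong cθ) (isLatCong cφ)
    ; °-compat  = λ sx sy (t , u) → °-compat cθ sx sy t , °-compat cφ sx sy u
    }

  -- Joins in Con(L°°) are compatible with ° since L°° is closed under °.
  join-isConL°° : ∀ {θ φ} → IsConL°° θ → IsConL°° φ → IsConL°° (join L°° θ φ)
  join-isConL°° cθ cφ = record
    { isLatCong = join-isLatCong (∨-closed °°-retraction) (∧-closed °°-retraction)
                                 (isLatCong cθ) (isLatCong cφ)
    ; °-compat  = λ _ _ → join-map _° (λ {x} _ → L°°-° x) (°-compat cθ) (°-compat cφ)
    }

  module _ (P : Principal L) where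
    open Principal P
    open MSPairs L P

    D-∨d : ∀ x → D (x ∨ d)
    D-∨d x = Equivalence.from (D-is-↑d (x ∨ d)) (sym (y≤x∨y x d))

    D⇒∨d : ∀ {x} → D x → x ∨ d ≡ x
    D⇒∨d {x} Dx = begin
      x ∨ d        ≡⟨ cong (x ∨_) (sym (Equivalence.to (D-is-↑d x) Dx)) ⟩
      x ∨ (d ∧ x)  ≡⟨ cong (x ∨_) (∧-comm d x) ⟩
      x ∨ (x ∧ d)  ≡⟨ ∨-absorbs-∧ x d ⟩
      x            ∎

    ∨d-∨ : ∀ x y → (x ∨ y) ∨ d ≡ (x ∨ d) ∨ (y ∨ d)
    ∨d-∨ x y = begin
      (x ∨ y) ∨ d        ≡⟨ cong ((x ∨ y) ∨_) (sym (∨-idem d)) ⟩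
      (x ∨ y) ∨ (d ∨ d)  ≡⟨ interchange x y d d ⟩
      (x ∨ d) ∨ (y ∨ d)  ∎

    ∨d-retraction : Retraction D
    ∨d-retraction = record
      { r = _∨ d ; lands = D-∨d ; fixes = D⇒∨d ; r-∨ = ∨d-∨ ; r-∧ = λ x y → ∨-distribʳ-∧ d x y }

    D-°°-equal : ∀ {x y} → D x → D y → x ° ° ≡ y ° °
    D-°°-equal Dx Dy = cong _° (trans Dx (sym Dy))

    -- A congruence of L relating x°° to y°° and x ∨ d to y ∨ d relates x to y,
    -- because x = x°° ∧ (x ∨ d).
    determined : ∀ {θ} → IsCon θ → ∀ {x y} → θ (x ° °) (y ° °) → θ (x ∨ d) (y ∨ d) → θ x y
    determined {θ} c {x} {y} p q =
      subst₂ θ (sym (decomp x)) (sym (decomp y)) (∧-compat (isLatCong c) tt tt tt tt p q)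

    induced : Rel Carrier 0ℓ → Rel Carrier 0ℓ → Rel Carrier 0ℓ
    induced θ₁ θ₂ = pullback (λ x → x ° °) θ₁ ∩ pullback (_∨ d) θ₂

    -- For an MS-congruence pair it is a congruence: (x°)°° = (x°°)°, and the
    -- pair condition turns θ₁ (x°) (y°) into θ₂ (x° ∨ d) (y° ∨ d).
    induced-isCon : ∀ {θ₁ θ₂} → IsMSPair θ₁ θ₂ → IsCon (induced θ₁ θ₂)
    induced-isCon {θ₁} (c₁ , c₂ , pair) = record
      { isLatCong = ∩-isLatCong (pullback-isLatCong °°-retraction (isLatCong c₁))
                                (pullback-isLatCong ∨d-retraction c₂)
      ; °-compat  = λ {x} {y} _ _ (t₁ , _) →
          let t₁° = °-compat c₁ (L°°-° (x °)) (L°°-° (y °)) t₁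
          in t₁° , pair (L°°-° x) (L°°-° y) (subst₂ θ₁ (°°° x) (°°° y) t₁°)
      }

    induced-on-L°° : ∀ {θ₁ θ₂} → IsMSPair θ₁ θ₂ → Φ₁ (induced θ₁ θ₂) ≐[ L°° ] θ₁
    induced-on-L°° {θ₁} (_ , _ , pair) sx sy = mk⇔
      (λ (_ , _ , t₁ , _) → Equivalence.to (pullback-on-image °°-retraction θ₁ sx sy) t₁)
      (λ t → sx , sy , Equivalence.from (pullback-on-image °°-retraction θ₁ sx sy) t , pair sx sy t)

    induced-on-D : ∀ {θ₁ θ₂} → IsMSPair θ₁ θ₂ → Φ₂ (induced θ₁ θ₂) ≐[ D ] θ₂
    induced-on-D {θ₁} {θ₂} (c₁ , _ , _) {x} sx sy = mk⇔
      (λ (_ , _ , _ , t₂) → Equivalence.to (pullback-on-image ∨d-retraction θ₂ sx sy) t₂)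
      (λ t → sx , sy
           , subst (θ₁ (x ° °)) (D-°°-equal sx sy) (reflexive (isLatCong c₁) (L°°-° (x °)))
           , Equivalence.from (pullback-on-image ∨d-retraction θ₂ sx sy) t)

    restriction-isMSPair : ∀ θ → IsCon θ → IsMSPair (Φ₁ θ) (Φ₂ θ)
    restriction-isMSPair θ c =
      record { isLatCong = restrict-isLatCong °°-retraction (isLatCong c)
             ; °-compat  = λ {x} {y} _ _ (_ , _ , t) → L°°-° x , L°°-° y , °-compat c tt tt t } ,
      restrict-isLatCong ∨d-retraction (isLatCong c) ,
      λ {a} {b} _ _ (_ , _ , t) → D-∨d a , D-∨d b , ∨-compatible c d t

    -- Congruences with the same restrictions coincide: transport the relations
    -- on x°° and x ∨ d and reassemble x with `determined`.
    restriction-reflects : ∀ {θ φ} → IsCon θ → IsCon φ →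
                           Φ₁ θ ≐[ L°° ] Φ₁ φ → Φ₂ θ ≐[ D ] Φ₂ φ → ∀ {x y} → θ x y → φ x y
    restriction-reflects cθ cφ e₁ e₂ {x} {y} t = determined cφ
      (proj₂ (proj₂ (Equivalence.to (e₁ (L°°-° (x °)) (L°°-° (y °)))
                       (L°°-° (x °) , L°°-° (y °) , °°-compatible cθ t))))
      (proj₂ (proj₂ (Equivalence.to (e₂ (D-∨d x) (D-∨d y))
                       (D-∨d x , D-∨d y , ∨-compatible cθ d t))))

    pairs-form-sublattice : AIsSublattice
    pairs-form-sublattice _ _ _ _ (cθ₁ , cθ₂ , pθ) (cφ₁ , cφ₂ , pφ) =
      (∩-isConL°° cθ₁ cφ₁ , ∩-isLatCong cθ₂ cφ₂ , λ sa sb (t , u) → pθ sa sb t , pφ sa sb u) ,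
      (join-isConL°° cθ₁ cφ₁ ,
       join-isLatCong (∨-closed ∨d-retraction) (∧-closed ∨d-retraction) cθ₂ cφ₂ ,
       λ _ _ → join-map (_∨ d) (λ {x} _ → D-∨d x) pθ pφ)

    restriction-isomorphism : ΦIsIsomorphism
    restriction-isomorphism = record
      { into       = restriction-isMSPair
      ; injective  = λ _ _ cθ cφ e₁ e₂ _ _ →
          mk⇔ (restriction-reflects cθ cφ e₁ e₂)
              (restriction-reflects cφ cθ (λ sx sy → ⇔-sym (e₁ sx sy)) (λ sx sy → ⇔-sym (e₂ sx sy)))
      ; surjective = λ θ₁ θ₂ pair →
          induced θ₁ θ₂ , induced-isCon pair , induced-on-L°° pair , induced-on-D pair
      ; pres-meet  = λ θ φ _ _ → restrict-∩ L°° θ φ , restrict-∩ D θ φ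
      ; pres-join  = λ θ φ cθ cφ →
          restrict-join °°-retraction (°°-compatible cθ) (°°-compatible cφ) ,
          restrict-join ∨d-retraction (∨-compatible cθ d) (∨-compatible cφ d)
      }

corollary3p3 : (L : MSAlgebra) (P : Principal L) →
    MSPairs.AIsSublattice L P × MSPairs.ΦIsIsomorphism L P
corollary3p3 L P = pairs-form-sublattice L P , restriction-isomorphism L P
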